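{- Let $n\geqslant 4$ and $S\subseteq\mathbb{Z}_n$ be such that $\Gamma=\mathrm{CS}(\mathbb{Z}_n,S)$ is connected and of degree $k=|S|$. If $k\mid n$ and $s\not\equiv s'\pmod{k}$ for all distinct $s,s'\in S$, then $\Gamma$ admits a total perfect code; moreover, $k\mathbb{Z}_n=\{ki: 0\leqslant i<n/k\}$, a subgroup of $\mathbb{Z}_n$, is such a total perfect code.
   Context: For an abelian group $G$ and $S\subseteq G$, the Cayley sum graph $\mathrm{CS}(G,S)$ has vertex set $G$, two vertices $g,h$ adjacent iff $g+h\in S$ and $g\neq h$. A total perfect code of a graph is a set $C$ of vertices such that every vertex has exactly one neighbor in $C$. Elements of $\mathbb{Z}_n$ are identified with integers $0,\dots,n-1$. -}

module Defs where

open import Data.Nat using (ℕ; zero; suc; _+_; _*_; _<_)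
open import Data.Nat.DivMod using (_mod_)
open import Data.Fin using (Fin; toℕ)
open import Data.Fin.Subset using (Subset; _∈_; ∣_∣)
open import Data.Fin.Subset.Properties using (_∈?_)
open import Data.Fin.Properties using (_≟_)
open import Data.Vec using (tabulate)
open import Data.Product using (Σ; ∃; _×_)
open import Relation.Nullary using (¬_; Dec; yes; no; does; _×-dec_; ¬?)
open import Relation.Binary.PropositionalEquality using (_≡_; _≢_)
open import Relation.Binary.Construct.Closure.ReflexiveTransitive using (Star)

infixl 6 _⊕_
_⊕_ : ∀ {n} → Fin n → Fin n → Fin n
_⊕_ {suc n} g h = (toℕ g + toℕ h) mod suc n

Adj : ∀ {n} → Subset n → Fin n → Fin n → Set
Adj S g h = (g ⊕ h) ∈ S × g ≢ h

Adj? : ∀ {n} (S : Subset n) (g h : Fin n) → Dec (Adj S g h)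
Adj? S g h = ((g ⊕ h) ∈? S) ×-dec ¬? (g ≟ h)

neighbours : ∀ {n} → Subset n → Fin n → Subset n
neighbours S g = tabulate (λ h → does (Adj? S g h))

degree : ∀ {n} → Subset n → Fin n → ℕ
degree S g = ∣ neighbours S g ∣

IsRegularOfDegree : ∀ {n} → Subset n → ℕ → Set
IsRegularOfDegree S k = ∀ g → degree S g ≡ k

IsConnected : ∀ {n} → Subset n → Set
IsConnected S = ∀ g h → Star (Adj S) g h

IsTotalPerfectCode : ∀ {n} → Subset n → (Fin n → Set) → Set
IsTotalPerfectCode {n} S C =
  ∀ (v : Fin n) → Σ (Fin n) λ c → C c × Adj S v c
                  × (∀ c′ → C c′ → Adj S v c′ → c′ ≡ c)

HasTotalPerfectCode : ∀ {n} → Subset n → Set₁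
HasTotalPerfectCode {n} S = Σ (Fin n → Set) λ C → IsTotalPerfectCode S C

kℤ : ∀ {n} → ℕ → Fin n → Set
kℤ {n} k v = ∃ λ i → k * i < n × toℕ v ≡ k * i

{-# OPTIONS --safe #-}
-- Regularity of degree |S| forces g + g ∉ S for every g: translation by g maps the
-- neighbourhood of g injectively into S, hence onto S by counting, and a preimage of g + g would be
-- g itself.  Having |S| = k pairwise incongruent elements, S meets every residue class
-- mod k exactly once.  For a vertex v let s ∈ S be congruent to v and c = s − v; as k ∣ n,
-- c ∈ kℤ_n, and c ≠ v since v + v ∉ S.  Any neighbour c′ ∈ kℤ_n of v gives v + c′ ∈ S
-- congruent to v, so v + c′ = s and c′ = c.
module Submission where

open import Defs
open import Data.Nat using (ℕ; _≤_; ∣_-_∣)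
open import Data.Nat.Divisibility using (_∣_)
open import Data.Fin using (Fin; toℕ)
open import Data.Fin.Subset using (Subset; _∈_; ∣_∣)
open import Data.Product using (_×_)
open import Relation.Nullary using (¬_)
open import Relation.Binary.PropositionalEquality using (_≡_; _≢_)

open import Data.Bool.Properties using (T-≡)
open import Data.Fin using (zero; suc; _≟_)
open import Data.Fin.Properties using (0≢1+n; suc-injective; toℕ-injective; toℕ<n; toℕ-fromℕ<; any?)
open import Data.Fin.Subset using (_∉_; ⊤; inside; outside) renaming (_-_ to _without_)
open import Data.Fin.Subset.Properties using (_∈?_; ∈⊤; ∣⊤∣≡n; x∈p⇒∣p-x∣<∣p∣; x∈p∧x≢y⇒x∈p-y)
open import Data.Nat using (zero; suc; _+_; _*_; _%_; _<_; z≤n; s≤s; NonZero)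
open import Data.Nat.DivMod using (_mod_; m≡m%n+[m/n]*n; [m+kn]%n≡m%n; m<n⇒m%n≡m; m∣n⇒o%n%m≡o%m; _/_)
open import Data.Nat.Divisibility using (divides; quotient; m∣n⇒n≡m*quotient; n∣m⇒m%n≡0; 0∣⇒≡0)
open import Data.Nat.Properties
  using (≤-refl; ≤-reflexive; ≤-trans; ≤-<-trans; <⇒≱; *-comm; ⊔-pres-<m; ∣m-n∣≤m⊔n; ∣m-n∣≡0⇒m≡n;
         ∣m+n-m+o∣≡∣n-o∣; ∣m-m+n∣≡n; ∣-∣-comm; *-distribʳ-∣-∣)
open import Data.Product using (∃; _,_; proj₁; proj₂)
open import Data.Vec using (_∷_; []; here; there; lookup)
open import Data.Vec.Properties using ([]=⇒lookup; lookup∘tabulate)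
open import Function using (_∘_)
open import Function.Bundles using (module Equivalence)
open import Relation.Nullary using (does; isYes; yes; no; _×-dec_; toWitness; decidable-stable; contradiction)
open import Relation.Nullary.Decidable using (isYes≗does)
open import Relation.Binary.PropositionalEquality using (refl; sym; trans; cong; subst; module ≡-Reasoning)

open ≡-Reasoning

MapsTo : ∀ {m n} → (Fin m → Fin n) → Subset m → Subset n → Set
MapsTo f p q = ∀ {x} → x ∈ p → f x ∈ q

InjectiveOn : ∀ {m n} → (Fin m → Fin n) → Subset m → Set
InjectiveOn f p = ∀ {x y} → x ∈ p → y ∈ p → f x ≡ f y → x ≡ y

injectiveOn-∷⁻ : ∀ {m n b} {p : Subset m} {f : Fin (suc m) → Fin n} →
  InjectiveOn f (b ∷ p) → InjectiveOn (f ∘ suc) p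
injectiveOn-∷⁻ f-inj x∈p y∈p = suc-injective ∘ f-inj (there x∈p) (there y∈p)

injectiveOn⇒∣p∣≤∣q∣ : ∀ {m n} {p : Subset m} {q : Subset n} (f : Fin m → Fin n) →
  MapsTo f p q → InjectiveOn f p → ∣ p ∣ ≤ ∣ q ∣
injectiveOn⇒∣p∣≤∣q∣ {p = []} f _ _ = z≤n
injectiveOn⇒∣p∣≤∣q∣ {p = outside ∷ p} f f-into f-inj =
  injectiveOn⇒∣p∣≤∣q∣ (f ∘ suc) (f-into ∘ there) (injectiveOn-∷⁻ f-inj)
injectiveOn⇒∣p∣≤∣q∣ {p = inside ∷ p} {q} f f-into f-inj =
  ≤-trans (s≤s (injectiveOn⇒∣p∣≤∣q∣ (f ∘ suc) into-rest (injectiveOn-∷⁻ f-inj)))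
          (x∈p⇒∣p-x∣<∣p∣ (f-into here))
  where
  into-rest : MapsTo (f ∘ suc) p (q without f zero)
  into-rest x∈p = x∈p∧x≢y⇒x∈p-y (f-into (there x∈p)) (λ eq → 0≢1+n (f-inj here (there x∈p) (sym eq)))

injectiveOn⇒surjectiveOn : ∀ {m n} {p : Subset m} {q : Subset n} (f : Fin m → Fin n) →
  MapsTo f p q → InjectiveOn f p → ∣ q ∣ ≤ ∣ p ∣ →
  ∀ {y} → y ∈ q → ∃ λ x → x ∈ p × f x ≡ y
injectiveOn⇒surjectiveOn {p = p} {q} f f-into f-inj ∣q∣≤∣p∣ {y} y∈q with any? (λ x → x ∈? p ×-dec f x ≟ y)
... | yes hit = hit
... | no miss = contradiction (≤-trans ∣q∣≤∣p∣ (injectiveOn⇒∣p∣≤∣q∣ f into-rest f-inj)) (<⇒≱ (x∈p⇒∣p-x∣<∣p∣ y∈q))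
  where
  into-rest : MapsTo f p (q without y)
  into-rest {x} x∈p = x∈p∧x≢y⇒x∈p-y (f-into x∈p) (λ fx≡y → miss (x , x∈p , fx≡y))

m%d≡n%d⇒d∣∣m-n∣ : ∀ m n d .{{_ : NonZero d}} → m % d ≡ n % d → d ∣ ∣ m - n ∣
m%d≡n%d⇒d∣∣m-n∣ m n d m%d≡n%d = divides ∣ m / d - n / d ∣ (begin
  ∣ m - n ∣                                 ≡⟨ cong₂-∣-∣ (m≡m%n+[m/n]*n m d) (m≡m%n+[m/n]*n n d) ⟩
  ∣ m % d + m / d * d - n % d + n / d * d ∣ ≡⟨ cong (λ r → ∣ r + m / d * d - n % d + n / d * d ∣) m%d≡n%d ⟩
  ∣ n % d + m / d * d - n % d + n / d * d ∣ ≡⟨ ∣m+n-m+o∣≡∣n-o∣ (n % d) _ _ ⟩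
  ∣ m / d * d - n / d * d ∣                 ≡⟨ *-distribʳ-∣-∣ d (m / d) (n / d) ⟨
  ∣ m / d - n / d ∣ * d                     ∎)
  where
  cong₂-∣-∣ : ∀ {a b c e} → a ≡ b → c ≡ e → ∣ a - c ∣ ≡ ∣ b - e ∣
  cong₂-∣-∣ refl refl = refl

toℕ-mod : ∀ m n .{{_ : NonZero n}} → toℕ (m mod n) ≡ m % n
toℕ-mod m n = toℕ-fromℕ< _

toℕ-⊕ : ∀ {n} (g h : Fin (suc n)) → toℕ (g ⊕ h) ≡ (toℕ g + toℕ h) % suc n
toℕ-⊕ {n} g h = toℕ-mod (toℕ g + toℕ h) (suc n)

⊕-cancelˡ : ∀ {n} (g : Fin (suc n)) {h h′} → g ⊕ h ≡ g ⊕ h′ → h ≡ h′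
⊕-cancelˡ {n} g {h} {h′} eq = toℕ-injective (∣m-n∣≡0⇒m≡n (begin
  ∣ toℕ h - toℕ h′ ∣           ≡⟨ m<n⇒m%n≡m (≤-<-trans (∣m-n∣≤m⊔n (toℕ h) (toℕ h′)) (⊔-pres-<m (toℕ<n h) (toℕ<n h′))) ⟨
  ∣ toℕ h - toℕ h′ ∣ % suc n   ≡⟨ n∣m⇒m%n≡0 _ (suc n) 1+n∣∣h-h′∣ ⟩
  0                            ∎))
  where
  1+n∣∣h-h′∣ : suc n ∣ ∣ toℕ h - toℕ h′ ∣
  1+n∣∣h-h′∣ = subst (suc n ∣_) (∣m+n-m+o∣≡∣n-o∣ (toℕ g) (toℕ h) (toℕ h′))
    (m%d≡n%d⇒d∣∣m-n∣ (toℕ g + toℕ h) (toℕ g + toℕ h′) (suc n) (trans (sym (toℕ-⊕ g h)) (trans (cong toℕ eq) (toℕ-⊕ g h′))))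

⊕-surjective : ∀ {n} (g h : Fin (suc n)) → ∃ λ c → g ⊕ c ≡ h
⊕-surjective g h with injectiveOn⇒surjectiveOn {p = ⊤} {q = ⊤} (g ⊕_) (λ _ → ∈⊤) (λ _ _ → ⊕-cancelˡ g) ≤-refl ∈⊤
... | c , _ , g⊕c≡h = c , g⊕c≡h

module _ {n k} .{{_ : NonZero k}} (k∣n : k ∣ suc n) where

  toℕ-⊕-%k : ∀ (g h : Fin (suc n)) → toℕ (g ⊕ h) % k ≡ (toℕ g + toℕ h) % k
  toℕ-⊕-%k g h = trans (cong (_% k) (toℕ-⊕ g h)) (m∣n⇒o%n%m≡o%m k (suc n) _ k∣n)

  kℤ⇒[g⊕c]%k≡g%k : ∀ g {c} → kℤ k c → toℕ (g ⊕ c) % k ≡ toℕ g % k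
  kℤ⇒[g⊕c]%k≡g%k g {c} (i , _ , c≡k*i) = begin
    toℕ (g ⊕ c) % k      ≡⟨ toℕ-⊕-%k g c ⟩
    (toℕ g + toℕ c) % k  ≡⟨ cong (λ x → (toℕ g + x) % k) (trans c≡k*i (*-comm k i)) ⟩
    (toℕ g + i * k) % k  ≡⟨ [m+kn]%n≡m%n (toℕ g) i k ⟩
    toℕ g % k            ∎

  [g⊕c]%k≡g%k⇒kℤ : ∀ g c → toℕ (g ⊕ c) % k ≡ toℕ g % k → kℤ k c
  [g⊕c]%k≡g%k⇒kℤ g c eq = quotient k∣c , subst (_< suc n) c≡k*q (toℕ<n c) , c≡k*q
    where
    k∣c : k ∣ toℕ c
    k∣c = subst (k ∣_) (trans (∣-∣-comm (toℕ g + toℕ c) (toℕ g)) (∣m-m+n∣≡n (toℕ g) (toℕ c)))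
            (m%d≡n%d⇒d∣∣m-n∣ (toℕ g + toℕ c) (toℕ g) k (trans (sym (toℕ-⊕-%k g c)) eq))
    c≡k*q : toℕ c ≡ k * quotient k∣c
    c≡k*q = m∣n⇒n≡m*quotient k∣c

record IsCompleteResidueSystem {n} (k : ℕ) .{{_ : NonZero k}} (S : Subset n) : Set where
  field
    represented : ∀ (g : Fin n) → ∃ λ s → s ∈ S × toℕ s % k ≡ toℕ g % k
    unique      : ∀ {s s′} → s ∈ S → s′ ∈ S → toℕ s % k ≡ toℕ s′ % k → s ≡ s′

distinctResidues⇒isCompleteResidueSystem : ∀ {n k} .{{_ : NonZero k}} {S : Subset n} → k ≡ ∣ S ∣ →
  (∀ s s′ → s ∈ S → s′ ∈ S → s ≢ s′ → ¬ (k ∣ ∣ toℕ s - toℕ s′ ∣)) → IsCompleteResidueSystem k S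
distinctResidues⇒isCompleteResidueSystem {n} {k} {S} k≡∣S∣ distinct = record
  { represented = represented
  ; unique      = unique
  }
  where
  unique : ∀ {s s′} → s ∈ S → s′ ∈ S → toℕ s % k ≡ toℕ s′ % k → s ≡ s′
  unique {s} {s′} s∈S s′∈S s≡s′ = decidable-stable (s ≟ s′)
    (λ s≢s′ → distinct s s′ s∈S s′∈S s≢s′ (m%d≡n%d⇒d∣∣m-n∣ _ _ k s≡s′))

  represented : ∀ (g : Fin n) → ∃ λ s → s ∈ S × toℕ s % k ≡ toℕ g % k
  represented g with injectiveOn⇒surjectiveOn (λ s → toℕ s mod k)
    (λ _ → ∈⊤)
    (λ s∈S s′∈S eq → unique s∈S s′∈S (trans (sym (toℕ-mod _ k)) (trans (cong toℕ eq) (toℕ-mod _ k))))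
    (≤-reflexive (trans (∣⊤∣≡n k) k≡∣S∣)) (∈⊤ {x = toℕ g mod k})
  ... | s , s∈S , eq = s , s∈S , trans (sym (toℕ-mod _ k)) (trans (cong toℕ eq) (toℕ-mod _ k))

∈-neighbours⁻ : ∀ {n} {S : Subset n} {g h} → h ∈ neighbours S g → Adj S g h
∈-neighbours⁻ {S = S} {g} {h} h∈N = toWitness {a? = Adj? S g h} (Equivalence.from T-≡ (begin
  isYes (Adj? S g h)                           ≡⟨ isYes≗does (Adj? S g h) ⟩
  does (Adj? S g h)                            ≡⟨ lookup∘tabulate (λ h → does (Adj? S g h)) h ⟨
  lookup (neighbours S g) h                    ≡⟨ []=⇒lookup h∈N ⟩
  inside                                       ∎))

∣S∣≤degree⇒g⊕g∉S : ∀ {n} (S : Subset (suc n)) g → ∣ S ∣ ≤ degree S g → g ⊕ g ∉ S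
∣S∣≤degree⇒g⊕g∉S S g ∣S∣≤deg g⊕g∈S
  with injectiveOn⇒surjectiveOn (g ⊕_) (proj₁ ∘ ∈-neighbours⁻ {S = S} {g}) (λ _ _ → ⊕-cancelˡ g) ∣S∣≤deg g⊕g∈S
... | h , h∈N , g⊕h≡g⊕g = proj₂ (∈-neighbours⁻ h∈N) (sym (⊕-cancelˡ g g⊕h≡g⊕g))

kℤ-isTotalPerfectCode : ∀ {n k} .{{_ : NonZero k}} {S : Subset (suc n)} → k ∣ suc n →
  (∀ g → g ⊕ g ∉ S) → IsCompleteResidueSystem k S → IsTotalPerfectCode S (kℤ k)
kℤ-isTotalPerfectCode {k = k} {S} k∣n loopless crs v
  with s , s∈S , s≡v ← IsCompleteResidueSystem.represented crs v
  with c , v⊕c≡s ← ⊕-surjective v s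
  = c , c∈kℤ , (v⊕c∈S , v≢c) , unique-neighbour
  where
  c∈kℤ : kℤ k c
  c∈kℤ = [g⊕c]%k≡g%k⇒kℤ k∣n v c (trans (cong (λ x → toℕ x % k) v⊕c≡s) s≡v)

  v⊕c∈S : v ⊕ c ∈ S
  v⊕c∈S = subst (_∈ S) (sym v⊕c≡s) s∈S

  v≢c : v ≢ c
  v≢c v≡c = loopless v (subst (λ x → v ⊕ x ∈ S) (sym v≡c) v⊕c∈S)

  unique-neighbour : ∀ c′ → kℤ k c′ → Adj S v c′ → c′ ≡ c
  unique-neighbour c′ c′∈kℤ (v⊕c′∈S , _) = ⊕-cancelˡ v (trans
    (IsCompleteResidueSystem.unique crs v⊕c′∈S s∈S (trans (kℤ⇒[g⊕c]%k≡g%k k∣n v c′∈kℤ) (sym s≡v)))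
    (sym v⊕c≡s))

lemma3p1 : (n : ℕ) → 4 ≤ n → (S : Subset n) → (k : ℕ) → k ≡ ∣ S ∣ →
    IsConnected S → IsRegularOfDegree S k →
    k ∣ n →
    (∀ s s′ → s ∈ S → s′ ∈ S → s ≢ s′ → ¬ (k ∣ ∣ toℕ s - toℕ s′ ∣)) →
    HasTotalPerfectCode S × IsTotalPerfectCode S (kℤ k)
lemma3p1 (suc n) _ S zero _ _ _ 0∣n _ with () ← 0∣⇒≡0 0∣n
lemma3p1 (suc n) _ S k@(suc _) k≡∣S∣ _ regular k∣n distinct = (kℤ k , code) , code
  where
  loopless : ∀ g → g ⊕ g ∉ S
  loopless g = ∣S∣≤degree⇒g⊕g∉S S g (≤-reflexive (trans (sym k≡∣S∣) (sym (regular g))))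

  code : IsTotalPerfectCode S (kℤ k)
  code = kℤ-isTotalPerfectCode k∣n loopless (distinctResidues⇒isCompleteResidueSystem k≡∣S∣ distinct)
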